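{- Let $r\in\mathbb{Q}$ with $1<r\ne 2$, and let $z\in(0,\infty)\setminus\{r^n:n\in\mathbb{Z}\}$. Then each of the following equations has at most one solution: (i) $r^a+1=(r^b+r^c)z$ with $a,b,c\in\mathbb{Z}$, $a\ge 0$, $b\ge c$; (ii) $r^a+1=r^b+r^cz$ with $a,b,c\in\mathbb{Z}$, $a\ge 0$; (iii) $r^a-1=(r^b-r^c)z$ with $a,b,c\in\mathbb{Z}$, $a>0$. Moreover, the conclusion for (iii) also holds when $r=2$ (i.e. for any $r\in\mathbb{Q}$ with $r>1$ and any $z\in(0,\infty)\setminus\{r^n:n\in\mathbb{Z}\}$, equation (iii) has at most one solution).
   Context: A solution of each equation means a triple $(a,b,c)$ of integers satisfying the stated constraints and the equation.
   Formalization: The parameter z ranges over the positive rationals that are not integer powers of r, rather than over all of $(0,\infty)\setminus\{r^n:n\in\mathbb{Z}\}$. -}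

module Defs where

open import Data.Nat using (ℕ; zero; suc)
open import Data.Integer using (ℤ; +_; -[1+_])
open import Data.Rational using (ℚ; 0ℚ; 1ℚ; _*_; 1/_; _≟_; ≢-nonZero)
open import Relation.Nullary using (yes; no)

_^ℕ_ : ℚ → ℕ → ℚ
r ^ℕ zero = 1ℚ
r ^ℕ suc n = r * (r ^ℕ n)

-- reciprocal, totalised by 0⁻¹ = 0 (only used for r > 1 in the statement)
inv : ℚ → ℚ
inv r with r ≟ 0ℚ
... | yes _ = 0ℚ
... | no r≢0 = 1/_ r {{≢-nonZero r≢0}}

_^ℤ_ : ℚ → ℤ → ℚ
r ^ℤ (+ n) = r ^ℕ n
r ^ℤ -[1+ n ] = inv r ^ℕ suc n

{-# OPTIONS --safe #-}

-- Write r = p/q in lowest terms.  Sums of integer powers of r lie in ℤ[1/q], and since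
-- p is prime to q, an element c rᵐ + rᵐ⁺¹ w with w ∈ ℤ[1/q] determines its leading
-- digit c modulo p.  Eliminating z between two solutions yields identities between sums
-- of powers of r, which are compared through their leading digits.
-- For (ii) the identity says that two triples of exponents have equal power sums; when
-- p ≥ 3 (that is, r ≠ 2) such triples agree as multisets, and the side conditions
-- b ≠ 0, b ≠ a leave only the trivial matching.
-- For (i) and (iii) a solution is normalised to F A = rᶜ F D z with F n = rⁿ + 1,
-- resp. F n = rⁿ⁺¹ − 1, and two normalised solutions give F A rᵏ F D′ = F A′ F D.  The
-- constant terms force k = 0, and then monotonicity of F and a comparison of the lowest
-- powers force A = A′ and D = D′.

module Submission where

open import Defs
open import Data.Integer using (ℤ; +_) renaming (_≤_ to _≤ℤ_; _<_ to _<ℤ_)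
open import Data.Rational using (ℚ; 0ℚ; 1ℚ; _+_; _-_; _*_; _<_)
open import Data.Product using (_×_)
open import Relation.Binary.PropositionalEquality using (_≡_; _≢_)

open import Algebra.Bundles using (AbelianGroup; CommutativeMonoid)
open import Data.Bool using (true; false; if_then_else_)
open import Data.Empty using (⊥)
open import Data.Integer as ℤ using (-[1+_])
import Data.Integer.Properties as ℤ
import Data.Integer.Tactic.RingSolver as ℤSolver
open import Data.List using (List; []; _∷_; _++_; length)
open import Data.List.Extrema ℤ.≤-totalOrder using (min; min≤⊤; min≤xs; argmin-sel)
open import Data.List.Membership.Propositional using (_∈_)
open import Data.List.Relation.Unary.All as All using (All; []; _∷_)
import Data.List.Relation.Unary.All.Properties as All
open import Data.List.Relation.Unary.Any using (here; there)
open import Data.Nat as ℕ using (ℕ; zero; suc; _∸_)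
open import Data.Nat.Coprimality as Coprimality using (Coprime; coprime-divisor; 1-coprimeTo)
open import Data.Nat.Divisibility using (_∣_; divides; ∣1⇒≡1; ∣⇒≤)
import Data.Nat.Properties as ℕ
open import Data.Product using (_,_; proj₁; proj₂; ∃-syntax)
open import Data.Rational using (mkℚ; -_; _≤_; ↥_; ↧_; ↧ₙ_; *<*; _≟_; ≢-nonZero; positive; nonNegative)
open import Data.Rational.Properties
open import Data.Rational.Solver using (module +-*-Solver)
import Data.Rational.Unnormalised as ℚᵘ
import Data.Rational.Unnormalised.Properties as ℚᵘ
open import Data.Sum using (inj₁; inj₂; [_,_]′)
open import Function using (id)
open import Relation.Binary.Definitions using (DecidableEquality; Monotonic₁; tri<; tri≈; tri>)
open import Relation.Binary.PropositionalEquality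
  using (refl; sym; trans; cong; cong₂; subst; subst₂; ≢-sym; module ≡-Reasoning)
open import Relation.Nullary using (¬_; yes; no; does; contradiction)

import Algebra.Properties.Group (AbelianGroup.group ℤ.+-0-abelianGroup) as ℤ+
import Algebra.Properties.Group +-0-group as ℚ+
import Algebra.Properties.CommutativeSemigroup (CommutativeMonoid.commutativeSemigroup *-1-commutativeMonoid) as ℚ*
open +-*-Solver using (solve; _:=_; _:+_; _:*_; _:-_; :-_; con)

i≤j⇒∃[k]j≡i+k : ∀ {i j} → i ℤ.≤ j → ∃[ k ] j ≡ i ℤ.+ + k
i≤j⇒∃[k]j≡i+k {i} {j} i≤j =
  ℤ.∣ j ℤ.- i ∣ , trans (plus-minus i j) (cong (ℤ._+_ i) (sym (ℤ.0≤i⇒+∣i∣≡i (ℤ.i≤j⇒0≤j-i i≤j))))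
  where
  plus-minus : ∀ i j → j ≡ i ℤ.+ (j ℤ.- i)
  plus-minus = ℤSolver.solve-∀

*-cancelˡ-pos : ∀ {x y w} → 0ℚ < x → x * y ≡ x * w → y ≡ w
*-cancelˡ-pos {x} 0<x eq =
  ≤-antisym (*-cancelˡ-≤-pos x {{positive 0<x}} (≤-reflexive eq)) (*-cancelˡ-≤-pos x {{positive 0<x}} (≤-reflexive (sym eq)))

*-pos : ∀ {x y} → 0ℚ < x → 0ℚ < y → 0ℚ < x * y
*-pos {x} {y} 0<x 0<y = positive⁻¹ (x * y) {{pos*pos⇒pos x {{positive 0<x}} y {{positive 0<y}}}}

x<x*y : ∀ {x y} → 0ℚ < x → 1ℚ < y → x < x * y
x<x*y {x} 0<x 1<y = subst (_< x * _) (*-identityʳ x) (*-monoʳ-<-pos x {{positive 0<x}} 1<y)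

x≤x*y : ∀ {x y} → 0ℚ < x → 1ℚ ≤ y → x ≤ x * y
x≤x*y {x} 0<x 1≤y = subst (_≤ x * _) (*-identityʳ x) (*-monoˡ-≤-nonNeg x {{nonNegative (<⇒≤ 0<x)}} 1≤y)

*-strictMono : ∀ {a a′ b b′} → 0ℚ < a → a < a′ → 0ℚ < b → b < b′ → a * b < a′ * b′
*-strictMono {a} {a′} {b} 0<a a<a′ 0<b b<b′ =
  <-trans (*-monoˡ-<-pos b {{positive 0<b}} a<a′) (*-monoʳ-<-pos a′ {{positive (<-trans 0<a a<a′)}} b<b′)

strictMono⇒injective : ∀ {F : ℕ → ℚ} → Monotonic₁ ℕ._<_ _<_ F → ∀ {m n} → F m ≡ F n → m ≡ n
strictMono⇒injective mono {m} {n} Fm≡Fn with ℕ.<-cmp m n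
... | tri< m<n _ _ = contradiction Fm≡Fn (<⇒≢ (mono m<n))
... | tri≈ _ m≡n _ = m≡n
... | tri> _ _ n<m = contradiction (sym Fm≡Fn) (<⇒≢ (mono n<m))

x*inv[x]≡1 : ∀ {x} → x ≢ 0ℚ → x * inv x ≡ 1ℚ
x*inv[x]≡1 {x} x≢0 with x ≟ 0ℚ
... | yes x≡0 = contradiction x≡0 x≢0
... | no  x≢0 = *-inverseʳ x {{≢-nonZero x≢0}}

inv-pos : ∀ {x} → 0ℚ < x → 0ℚ < inv x
inv-pos {x} 0<x with x ≟ 0ℚ
... | yes x≡0 = contradiction (sym x≡0) (<⇒≢ 0<x)
... | no  _   = positive⁻¹ _ {{1/pos⇒pos x {{positive 0<x}}}}

^ℕ-+ : ∀ x m n → x ^ℕ (m ℕ.+ n) ≡ x ^ℕ m * x ^ℕ n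
^ℕ-+ x zero    n = sym (*-identityˡ _)
^ℕ-+ x (suc m) n = trans (cong (x *_) (^ℕ-+ x m n)) (sym (*-assoc x _ _))

^ℕ-pos : ∀ {x} → 0ℚ < x → ∀ n → 0ℚ < x ^ℕ n
^ℕ-pos 0<x zero    = positive⁻¹ 1ℚ
^ℕ-pos 0<x (suc n) = *-pos 0<x (^ℕ-pos 0<x n)

^ℤ-pos : ∀ {x} → 0ℚ < x → ∀ i → 0ℚ < x ^ℤ i
^ℤ-pos 0<x (+ n)    = ^ℕ-pos 0<x n
^ℤ-pos 0<x -[1+ n ] = ^ℕ-pos (inv-pos 0<x) (suc n)

module _ {x : ℚ} (x≢0 : x ≢ 0ℚ) where

  x^n*inv[x]^n≡1 : ∀ n → x ^ℕ n * inv x ^ℕ n ≡ 1ℚ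
  x^n*inv[x]^n≡1 zero    = refl
  x^n*inv[x]^n≡1 (suc n) = begin
    (x * x ^ℕ n) * (inv x * inv x ^ℕ n)   ≡⟨ ℚ*.interchange x (x ^ℕ n) (inv x) (inv x ^ℕ n) ⟩
    (x * inv x) * (x ^ℕ n * inv x ^ℕ n)   ≡⟨ cong₂ _*_ (x*inv[x]≡1 x≢0) (x^n*inv[x]^n≡1 n) ⟩
    1ℚ * 1ℚ                               ≡⟨⟩
    1ℚ                                    ∎
    where
    open ≡-Reasoning

  ^ℤ-suc : ∀ i → x ^ℤ ℤ.suc i ≡ x ^ℤ i * x
  ^ℤ-suc (+ n)        = *-comm x (x ^ℕ n)
  ^ℤ-suc -[1+ zero ]  = sym (trans (cong (_* x) (*-identityʳ (inv x))) (trans (*-comm _ x) (x*inv[x]≡1 x≢0)))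
  ^ℤ-suc -[1+ suc n ] = sym (begin
    (inv x * (inv x * v)) * x   ≡⟨ ℚ*.xy∙z≈y∙zx (inv x) (inv x * v) x ⟩
    (inv x * v) * (x * inv x)   ≡⟨ cong ((inv x * v) *_) (x*inv[x]≡1 x≢0) ⟩
    (inv x * v) * 1ℚ            ≡⟨ *-identityʳ _ ⟩
    inv x * v                   ∎)
    where
    open ≡-Reasoning
    v : ℚ
    v = inv x ^ℕ n

  ^ℤ-+-ℕ : ∀ i n → x ^ℤ (i ℤ.+ + n) ≡ x ^ℤ i * x ^ℕ n
  ^ℤ-+-ℕ i zero    = trans (cong (x ^ℤ_) (ℤ.+-identityʳ i)) (sym (*-identityʳ _))
  ^ℤ-+-ℕ i (suc n) = begin
    x ^ℤ (i ℤ.+ ℤ.suc (+ n))    ≡⟨ cong (x ^ℤ_) (+-suc i (+ n)) ⟩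
    x ^ℤ ℤ.suc (i ℤ.+ + n)      ≡⟨ ^ℤ-suc (i ℤ.+ + n) ⟩
    x ^ℤ (i ℤ.+ + n) * x        ≡⟨ cong (_* x) (^ℤ-+-ℕ i n) ⟩
    (x ^ℤ i * x ^ℕ n) * x       ≡⟨ ℚ*.xy∙z≈x∙zy (x ^ℤ i) (x ^ℕ n) x ⟩
    x ^ℤ i * (x * x ^ℕ n)       ∎
    where
    open ≡-Reasoning
    +-suc : ∀ i j → i ℤ.+ (ℤ.1ℤ ℤ.+ j) ≡ ℤ.1ℤ ℤ.+ (i ℤ.+ j)
    +-suc = ℤSolver.solve-∀

  ^ℤ-+ : ∀ i j → x ^ℤ (i ℤ.+ j) ≡ x ^ℤ i * x ^ℤ j
  ^ℤ-+ i (+ n)    = ^ℤ-+-ℕ i n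
  ^ℤ-+ i -[1+ n ] = sym (begin
    x ^ℤ i * u                       ≡⟨ cong (λ k → x ^ℤ k * u) (minus-plus i (+ suc n)) ⟩
    x ^ℤ (k ℤ.+ + suc n) * u         ≡⟨ cong (_* u) (^ℤ-+-ℕ k (suc n)) ⟩
    (x ^ℤ k * x ^ℕ suc n) * u        ≡⟨ *-assoc (x ^ℤ k) _ u ⟩
    x ^ℤ k * (x ^ℕ suc n * u)        ≡⟨ cong (x ^ℤ k *_) (x^n*inv[x]^n≡1 (suc n)) ⟩
    x ^ℤ k * 1ℚ                      ≡⟨ *-identityʳ _ ⟩
    x ^ℤ k                           ∎)
    where
    open ≡-Reasoning
    u : ℚ
    u = inv x ^ℕ suc n
    k : ℤ
    k = i ℤ.+ -[1+ n ]
    minus-plus : ∀ i j → i ≡ (i ℤ.+ ℤ.- j) ℤ.+ j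
    minus-plus = ℤSolver.solve-∀

module _ {x : ℚ} (1<x : 1ℚ < x) where

  private
    0<x : 0ℚ < x
    0<x = <-trans (positive⁻¹ 1ℚ) 1<x

  1≤^ℕ : ∀ n → 1ℚ ≤ x ^ℕ n
  1≤^ℕ zero    = ≤-refl
  1≤^ℕ (suc n) = ≤-trans (<⇒≤ 1<x) (x≤x*y 0<x (1≤^ℕ n))

  1<^ℕ-suc : ∀ n → 1ℚ < x ^ℕ suc n
  1<^ℕ-suc n = <-≤-trans 1<x (x≤x*y 0<x (1≤^ℕ n))

  ^ℕ-strictMono : Monotonic₁ ℕ._<_ _<_ (x ^ℕ_)
  ^ℕ-strictMono {m} {n} m<n with ℕ.m≤n⇒∃[o]m+o≡n m<n
  ... | k , refl = subst (x ^ℕ m <_) (sym (trans (cong (x ^ℕ_) (sym (ℕ.+-suc m k))) (^ℕ-+ x m (suc k))))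
                     (x<x*y (^ℕ-pos 0<x m) (1<^ℕ-suc k))

  ^ℤ-mono-≤ : Monotonic₁ ℤ._≤_ _≤_ (x ^ℤ_)
  ^ℤ-mono-≤ {i} i≤j with i≤j⇒∃[k]j≡i+k i≤j
  ... | k , refl = subst (x ^ℤ i ≤_) (sym (^ℤ-+-ℕ (≢-sym (<⇒≢ 0<x)) i k)) (x≤x*y (^ℤ-pos 0<x i) (1≤^ℕ k))

-- Numerators and denominators

ι : ℤ → ℚ
ι i = mkℚ i 0 (Coprimality.sym (1-coprimeTo _))

ι-injective : ∀ {i j} → ι i ≡ ι j → i ≡ j
ι-injective = cong ↥_

ι-+ : ∀ i j → ι i + ι j ≡ ι (i ℤ.+ j)
ι-+ i j = toℚᵘ-injective (ℚᵘ.≃-trans (toℚᵘ-homo-+ (ι i) (ι j)) (ℚᵘ.*≡* (scale i j)))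
  where
  scale : ∀ i j → (i ℤ.* ℤ.1ℤ ℤ.+ j ℤ.* ℤ.1ℤ) ℤ.* ℤ.1ℤ ≡ (i ℤ.+ j) ℤ.* ℤ.1ℤ
  scale = ℤSolver.solve-∀

ι-* : ∀ i j → ι i * ι j ≡ ι (i ℤ.* j)
ι-* i j = toℚᵘ-injective (ℚᵘ.≃-trans (toℚᵘ-homo-* (ι i) (ι j)) (ℚᵘ.*≡* refl))

ι-neg : ∀ i → - ι i ≡ ι (ℤ.- i)
ι-neg -[1+ n ]  = refl
ι-neg (+ zero)  = refl
ι-neg (+ suc n) = refl

ι-suc : ∀ n → ι (+ suc n) ≡ 1ℚ + ι (+ n)
ι-suc n = sym (ι-+ (+ 1) (+ n))

ι-pos : ∀ {n} → 0 ℕ.< n → 0ℚ < ι (+ n)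
ι-pos {suc n} _ = *<* (ℤ.+<+ (ℕ.s≤s ℕ.z≤n))

x*↧x≡↥x : ∀ x → x * ι (↧ x) ≡ ι (↥ x)
x*↧x≡↥x x@(mkℚ n d _) = toℚᵘ-injective (ℚᵘ.≃-trans (toℚᵘ-homo-* x (ι (+ suc d))) (ℚᵘ.*≡* cross))
  where
  cross : n ℤ.* + suc d ℤ.* ℤ.1ℤ ≡ n ℤ.* + (suc d ℕ.* 1)
  cross = trans (ℤ.*-identityʳ _) (cong (λ k → n ℤ.* + k) (sym (ℕ.*-identityʳ (suc d))))

↥⊥↧ : ∀ x → Coprime ℤ.∣ ↥ x ∣ (↧ₙ x)
↥⊥↧ (mkℚ _ _ n⊥d) = Coprimality.recompute n⊥d

coprime-divisor-^ : ∀ {m n o} k → Coprime m n → m ∣ n ℕ.^ k ℕ.* o → m ∣ o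
coprime-divisor-^ {m} {o = o} zero    m⊥n m∣o   = subst (m ∣_) (ℕ.+-identityʳ o) m∣o
coprime-divisor-^ {m} {n} {o} (suc k) m⊥n m∣nᵏo =
  coprime-divisor-^ k m⊥n (coprime-divisor m⊥n (subst (m ∣_) (ℕ.*-assoc n (n ℕ.^ k) o) m∣nᵏo))

↧<↥ᶻ : ∀ {x} → 1ℚ < x → ↧ x ℤ.< ↥ x
↧<↥ᶻ {x@record{}} (*<* d<n) = subst₂ ℤ._<_ (ℤ.*-identityˡ (↧ x)) (ℤ.*-identityʳ (↥ x)) d<n

↧<↥ : ∀ {x} → 1ℚ < x → ↧ₙ x ℕ.< ℤ.∣ ↥ x ∣
↧<↥ {x@(mkℚ (+ n) _ _)}    1<x = ℤ.drop‿+<+ (↧<↥ᶻ {x} 1<x)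
↧<↥ {x@(mkℚ -[1+ n ] _ _)} 1<x with ↧<↥ᶻ {x} 1<x
... | ()

3≤∣↥∣ : ∀ {x} → 1ℚ < x → x ≢ 1ℚ + 1ℚ → 3 ℕ.≤ ℤ.∣ ↥ x ∣
3≤∣↥∣ {mkℚ (+ 2) zero _} 1<x x≢2 = contradiction refl x≢2
3≤∣↥∣ {x@(mkℚ (+ 2) (suc _) _)} 1<x x≢2 with ↧<↥ {x} 1<x
... | ℕ.s≤s (ℕ.s≤s ())
3≤∣↥∣ {mkℚ (+ suc (suc (suc n))) _ _} 1<x x≢2 = ℕ.s≤s (ℕ.s≤s (ℕ.s≤s ℕ.z≤n))
3≤∣↥∣ {x@(mkℚ (+ 0) _ _)} 1<x x≢2 with ↧<↥ {x} 1<x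
... | ()
3≤∣↥∣ {x@(mkℚ (+ 1) _ _)} 1<x x≢2 with ↧<↥ {x} 1<x
... | ℕ.s≤s ()
3≤∣↥∣ {x@(mkℚ -[1+ n ] _ _)} 1<x x≢2 with ↧<↥ᶻ {x} 1<x
... | ()

divisible-gap⇒extremes : ∀ {d a b n} → d ∣ b ∸ a → a ℕ.< b → b ℕ.≤ n → n ℕ.≤ d → a ≡ 0 × b ≡ n
divisible-gap⇒extremes {d} {a} {b} {n} d∣gap a<b b≤n n≤d = a≡0 , b≡n
  where
  n≤gap : n ℕ.≤ b ∸ a
  n≤gap = ℕ.≤-trans n≤d (∣⇒≤ {{ℕ.>-nonZero (ℕ.m<n⇒0<n∸m a<b)}} d∣gap)
  b≡n : b ≡ n
  b≡n = ℕ.≤-antisym b≤n (ℕ.≤-trans n≤gap (ℕ.m∸n≤m b a))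
  a≡0 : a ≡ 0
  a≡0 = ℕ.n≤0⇒n≡0 (ℕ.+-cancelʳ-≤ (b ∸ a) a 0 (begin
    a ℕ.+ (b ∸ a)   ≡⟨ ℕ.m+[n∸m]≡n (ℕ.<⇒≤ a<b) ⟩
    b               ≤⟨ b≤n ⟩
    n               ≤⟨ n≤gap ⟩
    b ∸ a           ∎))
    where open ℕ.≤-Reasoning

-- Multiplicities

module Multiplicity {A : Set} (_≟ᴬ_ : DecidableEquality A) where

  count : A → List A → ℕ
  count e []       = 0
  count e (x ∷ xs) = if does (e ≟ᴬ x) then suc (count e xs) else count e xs

  remove : A → List A → List A
  remove e []       = []
  remove e (x ∷ xs) = if does (e ≟ᴬ x) then remove e xs else x ∷ remove e xs

  infix 4 _≈ᵇ_
  record _≈ᵇ_ (xs ys : List A) : Set where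
    constructor same-counts
    field count-≡ : ∀ e → count e xs ≡ count e ys
  open _≈ᵇ_ public

  ≈ᵇ-sym : ∀ {xs ys} → xs ≈ᵇ ys → ys ≈ᵇ xs
  ≈ᵇ-sym (same-counts eq) = same-counts λ e → sym (eq e)

  ≈ᵇ-trans : ∀ {xs ys zs} → xs ≈ᵇ ys → ys ≈ᵇ zs → xs ≈ᵇ zs
  ≈ᵇ-trans (same-counts eq) (same-counts eq′) = same-counts λ e → trans (eq e) (eq′ e)

  length-remove : ∀ e xs → length (remove e xs) ℕ.+ count e xs ≡ length xs
  length-remove e []       = refl
  length-remove e (x ∷ xs) with e ≟ᴬ x
  ... | yes _ = trans (ℕ.+-suc _ _) (cong suc (length-remove e xs))
  ... | no  _ = cong suc (length-remove e xs)

  count≤length : ∀ e xs → count e xs ℕ.≤ length xs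
  count≤length e xs = subst (count e xs ℕ.≤_) (length-remove e xs) (ℕ.m≤n+m _ _)

  length-remove≤ : ∀ e xs → length (remove e xs) ℕ.≤ length xs
  length-remove≤ e xs = subst (length (remove e xs) ℕ.≤_) (length-remove e xs) (ℕ.m≤m+n _ _)

  length-remove< : ∀ e xs → 0 ℕ.< count e xs → length (remove e xs) ℕ.< length xs
  length-remove< e xs 0<c = subst (length (remove e xs) ℕ.<_) (length-remove e xs) (ℕ.m<m+n _ 0<c)

  count≡length⇒remove≡[] : ∀ e xs → count e xs ≡ length xs → remove e xs ≡ []
  count≡length⇒remove≡[] e xs c≡n with remove e xs | length-remove e xs
  ... | []    | _   = refl
  ... | _ ∷ _ | len = contradiction (sym (trans len (sym c≡n))) (ℕ.m≢1+n+m (count e xs))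

  count-remove : ∀ {e e′} xs → e ≢ e′ → count e (remove e′ xs) ≡ count e xs
  count-remove []       e≢e′ = refl
  count-remove {e} {e′} (x ∷ xs) e≢e′ with e′ ≟ᴬ x
  ... | yes refl with e ≟ᴬ e′
  ...   | yes e≡e′ = contradiction e≡e′ e≢e′
  ...   | no  _    = count-remove xs e≢e′
  count-remove {e} (x ∷ xs) e≢e′ | no _ with e ≟ᴬ x
  ...   | yes _ = cong suc (count-remove xs e≢e′)
  ...   | no  _ = count-remove xs e≢e′

  count-++ : ∀ e xs ys → count e (xs ++ ys) ≡ count e xs ℕ.+ count e ys
  count-++ e []       ys = refl
  count-++ e (x ∷ xs) ys with e ≟ᴬ x
  ... | yes _ = cong suc (count-++ e xs ys)
  ... | no  _ = count-++ e xs ys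

  ∈⇒0<count : ∀ {e xs} → e ∈ xs → 0 ℕ.< count e xs
  ∈⇒0<count {e} {x ∷ xs} e∈ with e ≟ᴬ x | e∈
  ... | yes _   | _          = ℕ.s≤s ℕ.z≤n
  ... | no  e≢x | here e≡x   = contradiction e≡x e≢x
  ... | no  _   | there e∈xs = ∈⇒0<count e∈xs

  0<count⇒∈ : ∀ {e} xs → 0 ℕ.< count e xs → e ∈ xs
  0<count⇒∈ {e} (x ∷ xs) 0<c with e ≟ᴬ x
  ... | yes e≡x = here e≡x
  ... | no  _   = there (0<count⇒∈ xs 0<c)

  ≈ᵇ-∈ : ∀ {e xs ys} → xs ≈ᵇ ys → e ∈ xs → e ∈ ys
  ≈ᵇ-∈ {ys = ys} xs≈ys e∈xs = 0<count⇒∈ ys (subst (0 ℕ.<_) (count-≡ xs≈ys _) (∈⇒0<count e∈xs))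

  ≈ᵇ-drop-∷ : ∀ {x xs ys} → x ∷ xs ≈ᵇ x ∷ ys → xs ≈ᵇ ys
  ≈ᵇ-drop-∷ {x} {xs} {ys} x∷xs≈x∷ys = same-counts λ e → drop e (count-≡ x∷xs≈x∷ys e)
    where
    drop : ∀ e → count e (x ∷ xs) ≡ count e (x ∷ ys) → count e xs ≡ count e ys
    drop e eq with e ≟ᴬ x | eq
    ... | yes _ | c≡c′ = ℕ.suc-injective c≡c′
    ... | no  _ | c≡c′ = c≡c′

  ≈ᵇ-swap : ∀ x y zs → x ∷ y ∷ zs ≈ᵇ y ∷ x ∷ zs
  ≈ᵇ-swap x y zs = same-counts swap
    where
    swap : ∀ e → count e (x ∷ y ∷ zs) ≡ count e (y ∷ x ∷ zs)
    swap e with does (e ≟ᴬ x) | does (e ≟ᴬ y)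
    ... | true  | true  = refl
    ... | true  | false = refl
    ... | false | true  = refl
    ... | false | false = refl

  ≈ᵇ-remove : ∀ e xs ys → count e xs ≡ count e ys → remove e xs ≈ᵇ remove e ys → xs ≈ᵇ ys
  ≈ᵇ-remove e xs ys cx≡cy (same-counts rest) = same-counts restore
    where
    restore : ∀ e′ → count e′ xs ≡ count e′ ys
    restore e′ with e′ ≟ᴬ e
    ... | yes refl = cx≡cy
    ... | no e′≢e  = trans (sym (count-remove xs e′≢e)) (trans (rest e′) (count-remove ys e′≢e))

open Multiplicity ℤ._≟_

x≡y+x⇒y≡0 : ∀ {x y} → x ≡ y ℤ.+ x → y ≡ + 0
x≡y+x⇒y≡0 {x} {y} x≡y+x = ℤ+.∙-cancelʳ x y (+ 0) (trans (sym x≡y+x) (sym (ℤ.+-identityˡ x)))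

middle-exponents-match : ∀ {A A′ b c b′ c′} → b ≢ + 0 → b′ ≢ + 0 →
                         + A ℤ.+ c′ ∷ c′ ∷ b′ ℤ.+ c ∷ [] ≈ᵇ + A′ ℤ.+ c ∷ c ∷ b ℤ.+ c′ ∷ [] → c ≡ c′
middle-exponents-match {A} {A′} {b} {c} {b′} {c′} b≢0 b′≢0 L≈R
  with ≈ᵇ-∈ L≈R (there (here refl)) | ≈ᵇ-∈ (≈ᵇ-sym L≈R) (there (here refl))
... | there (here c′≡c)            | _                           = sym c′≡c
... | there (there (here c′≡b+c′)) | _                           = contradiction (x≡y+x⇒y≡0 c′≡b+c′) b≢0
... | here _                       | there (here c≡c′)           = c≡c′
... | here _                       | there (there (here c≡b′+c)) = contradiction (x≡y+x⇒y≡0 c≡b′+c) b′≢0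
... | here c′≡A′+c                 | here c≡A+c′                 =
  trans (sym (ℤ.+-identityˡ c)) (trans (cong (λ n → + n ℤ.+ c) (sym A′≡0)) (sym c′≡A′+c))
  where
  A+A′≡0 : + (A ℕ.+ A′) ≡ + 0
  A+A′≡0 = x≡y+x⇒y≡0 (begin
    c                      ≡⟨ c≡A+c′ ⟩
    + A ℤ.+ c′             ≡⟨ cong (ℤ._+_ (+ A)) c′≡A′+c ⟩
    + A ℤ.+ (+ A′ ℤ.+ c)   ≡⟨ sym (ℤ.+-assoc (+ A) (+ A′) c) ⟩
    + (A ℕ.+ A′) ℤ.+ c     ∎)
    where open ≡-Reasoning
  A′≡0 : A′ ≡ 0
  A′≡0 = ℕ.m+n≡0⇒n≡0 A (ℤ.+-injective A+A′≡0)

outer-exponents-match : ∀ {A A′ b b′ c} → b ≢ + A →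
                        + A ℤ.+ c ∷ b′ ℤ.+ c ∷ [] ≈ᵇ + A′ ℤ.+ c ∷ b ℤ.+ c ∷ [] → A ≡ A′ × b ≡ b′
outer-exponents-match {A} {A′} {b} {b′} {c} b≢A L≈R with ≈ᵇ-∈ L≈R (here refl)
... | there (here A+c≡b+c) = contradiction (sym (ℤ+.∙-cancelʳ c (+ A) b A+c≡b+c)) b≢A
... | here A+c≡A′+c with ℤ+.∙-cancelʳ c (+ A) (+ A′) A+c≡A′+c
... | refl with ≈ᵇ-∈ (≈ᵇ-drop-∷ L≈R) (here refl)
... | here b′+c≡b+c = refl , sym (ℤ+.∙-cancelʳ c b′ b b′+c≡b+c)

exponents-match : ∀ {A A′ b c b′ c′} → b ≢ + 0 → b′ ≢ + 0 → b ≢ + A →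
                  + A ℤ.+ c′ ∷ c′ ∷ b′ ℤ.+ c ∷ [] ≈ᵇ + A′ ℤ.+ c ∷ c ∷ b ℤ.+ c′ ∷ [] →
                  A ≡ A′ × b ≡ b′ × c ≡ c′
exponents-match {A} {A′} {b} {c} {b′} b≢0 b′≢0 b≢A L≈R with middle-exponents-match b≢0 b′≢0 L≈R
... | refl with outer-exponents-match b≢A (≈ᵇ-drop-∷ (≈ᵇ-trans (≈ᵇ-swap c _ _) (≈ᵇ-trans L≈R (≈ᵇ-swap _ c _))))
... | A≡A′ , b≡b′ = A≡A′ , b≡b′ , refl

-- Leading r-adic digits in ℤ[1/q], for r = p/q in lowest terms

module _ (r : ℚ) (1<r : 1ℚ < r) where

  p q : ℕ
  p = ℤ.∣ ↥ r ∣
  q = ↧ₙ r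

  2≤p : 2 ℕ.≤ p
  2≤p = ℕ.≤-trans (ℕ.s≤s (ℕ.s≤s ℕ.z≤n)) (↧<↥ 1<r)

  p∤1 : ¬ p ∣ 1
  p∤1 p∣1 = ℕ.<-irrefl (sym (∣1⇒≡1 p∣1)) 2≤p

  0<r : 0ℚ < r
  0<r = <-trans (positive⁻¹ 1ℚ) 1<r

  r≢0 : r ≢ 0ℚ
  r≢0 = ≢-sym (<⇒≢ 0<r)

  record _∈ℤ[1/q] (x : ℚ) : Set where
    constructor cleared-by-q^
    field
      k : ℕ
      n : ℤ
      x*qᵏ≡n : x * ι (+ (q ℕ.^ k)) ≡ ι n

  ι-q^-+ : ∀ k l → ι (+ (q ℕ.^ (k ℕ.+ l))) ≡ ι (+ (q ℕ.^ k)) * ι (+ (q ℕ.^ l))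
  ι-q^-+ k l = trans (cong (λ n → ι (+ n)) (ℕ.^-distribˡ-+-* q k l))
                     (trans (cong ι (ℤ.pos-* (q ℕ.^ k) (q ℕ.^ l))) (sym (ι-* (+ (q ℕ.^ k)) (+ (q ℕ.^ l)))))

  ∈-ι : ∀ n → ι n ∈ℤ[1/q]
  ∈-ι n = cleared-by-q^ 0 n (*-identityʳ (ι n))

  ∈-+ : ∀ {x y} → x ∈ℤ[1/q] → y ∈ℤ[1/q] → (x + y) ∈ℤ[1/q]
  ∈-+ {x} {y} (cleared-by-q^ k m xQᵏ≡m) (cleared-by-q^ l n yQˡ≡n) =
    cleared-by-q^ (k ℕ.+ l) (m ℤ.* + (q ℕ.^ l) ℤ.+ n ℤ.* + (q ℕ.^ k)) (begin
      (x + y) * ι (+ (q ℕ.^ (k ℕ.+ l)))                ≡⟨ cong ((x + y) *_) (ι-q^-+ k l) ⟩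
      (x + y) * (Qᵏ * Qˡ)                              ≡⟨ distribute x y Qᵏ Qˡ ⟩
      x * Qᵏ * Qˡ + y * Qˡ * Qᵏ                        ≡⟨ cong₂ (λ s t → s * Qˡ + t * Qᵏ) xQᵏ≡m yQˡ≡n ⟩
      ι m * Qˡ + ι n * Qᵏ                              ≡⟨ cong₂ _+_ (ι-* m _) (ι-* n _) ⟩
      ι (m ℤ.* + (q ℕ.^ l)) + ι (n ℤ.* + (q ℕ.^ k))    ≡⟨ ι-+ (m ℤ.* + (q ℕ.^ l)) (n ℤ.* + (q ℕ.^ k)) ⟩
      ι (m ℤ.* + (q ℕ.^ l) ℤ.+ n ℤ.* + (q ℕ.^ k))     ∎)
    where
    open ≡-Reasoning
    Qᵏ Qˡ : ℚ
    Qᵏ = ι (+ (q ℕ.^ k))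
    Qˡ = ι (+ (q ℕ.^ l))
    distribute : ∀ a b c d → (a + b) * (c * d) ≡ a * c * d + b * d * c
    distribute = solve 4 (λ a b c d → (a :+ b) :* (c :* d) := a :* c :* d :+ b :* d :* c) refl

  ∈-* : ∀ {x y} → x ∈ℤ[1/q] → y ∈ℤ[1/q] → (x * y) ∈ℤ[1/q]
  ∈-* {x} {y} (cleared-by-q^ k m xQᵏ≡m) (cleared-by-q^ l n yQˡ≡n) =
    cleared-by-q^ (k ℕ.+ l) (m ℤ.* n) (begin
      (x * y) * ι (+ (q ℕ.^ (k ℕ.+ l)))      ≡⟨ cong ((x * y) *_) (ι-q^-+ k l) ⟩
      (x * y) * (Qᵏ * Qˡ)                    ≡⟨ ℚ*.interchange x y Qᵏ Qˡ ⟩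
      (x * Qᵏ) * (y * Qˡ)                    ≡⟨ cong₂ _*_ xQᵏ≡m yQˡ≡n ⟩
      ι m * ι n                              ≡⟨ ι-* m n ⟩
      ι (m ℤ.* n)                            ∎)
    where
    open ≡-Reasoning
    Qᵏ Qˡ : ℚ
    Qᵏ = ι (+ (q ℕ.^ k))
    Qˡ = ι (+ (q ℕ.^ l))

  ∈-neg : ∀ {x} → x ∈ℤ[1/q] → (- x) ∈ℤ[1/q]
  ∈-neg {x} (cleared-by-q^ k m xQᵏ≡m) =
    cleared-by-q^ k (ℤ.- m) (trans (sym (neg-distribˡ-* x _)) (trans (cong -_ xQᵏ≡m) (ι-neg m)))

  ∈-r : r ∈ℤ[1/q]
  ∈-r = cleared-by-q^ 1 (↥ r) (trans (cong (λ n → r * ι (+ n)) (ℕ.*-identityʳ q)) (x*↧x≡↥x r))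

  ∈-^ℕ : ∀ n → (r ^ℕ n) ∈ℤ[1/q]
  ∈-^ℕ zero    = ∈-ι (+ 1)
  ∈-^ℕ (suc n) = ∈-* ∈-r (∈-^ℕ n)

  -- Clearing denominators turns c = r w into c qᵏ⁺¹ = p n, and p is coprime to q.
  r*w≡c⇒p∣c : ∀ {w} c → w ∈ℤ[1/q] → r * w ≡ ι c → p ∣ ℤ.∣ c ∣
  r*w≡c⇒p∣c {w} c (cleared-by-q^ k n wQᵏ≡n) rw≡c = coprime-divisor-^ (suc k) (↥⊥↧ r) (divides ℤ.∣ n ∣ (begin
    q ℕ.^ suc k ℕ.* ℤ.∣ c ∣          ≡⟨ ℕ.*-comm (q ℕ.^ suc k) _ ⟩
    ℤ.∣ c ∣ ℕ.* q ℕ.^ suc k          ≡⟨ sym (ℤ.abs-* c _) ⟩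
    ℤ.∣ c ℤ.* + (q ℕ.^ suc k) ∣      ≡⟨ cong ℤ.∣_∣ (ι-injective cQᵏ⁺¹≡pn) ⟩
    ℤ.∣ ↥ r ℤ.* n ∣                  ≡⟨ ℤ.abs-* (↥ r) n ⟩
    p ℕ.* ℤ.∣ n ∣                    ≡⟨ ℕ.*-comm p _ ⟩
    ℤ.∣ n ∣ ℕ.* p                    ∎))
    where
    open ≡-Reasoning
    Qᵏ : ℚ
    Qᵏ = ι (+ (q ℕ.^ k))
    cQᵏ⁺¹≡pn : ι (c ℤ.* + (q ℕ.^ suc k)) ≡ ι (↥ r ℤ.* n)
    cQᵏ⁺¹≡pn = begin
      ι (c ℤ.* + (q ℕ.^ suc k))           ≡⟨ sym (ι-* c _) ⟩
      ι c * ι (+ (q ℕ.^ suc k))           ≡⟨ cong₂ _*_ (sym rw≡c) (ι-q^-+ 1 k) ⟩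
      (r * w) * (ι (+ (q ℕ.^ 1)) * Qᵏ)    ≡⟨ cong (λ m → (r * w) * (ι (+ m) * Qᵏ)) (ℕ.*-identityʳ q) ⟩
      (r * w) * (ι (↧ r) * Qᵏ)            ≡⟨ ℚ*.interchange r w (ι (↧ r)) Qᵏ ⟩
      (r * ι (↧ r)) * (w * Qᵏ)            ≡⟨ cong₂ _*_ (x*↧x≡↥x r) wQᵏ≡n ⟩
      ι (↥ r) * ι n                       ≡⟨ ι-* (↥ r) n ⟩
      ι (↥ r ℤ.* n)                       ∎

  -- x ≡ c ·r^ m says x ≡ c rᵐ modulo rᵐ⁺¹ ℤ[1/q].
  infix 4 _≡_·r^_
  record _≡_·r^_ (x : ℚ) (c m : ℤ) : Set where
    constructor expansion
    field
      {w} : ℚ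
      w∈  : w ∈ℤ[1/q]
      x≡  : x ≡ r ^ℤ m * (ι c + r * w)

  ·r^-unique : ∀ {x c d m} → x ≡ c ·r^ m → x ≡ d ·r^ m → p ∣ ℤ.∣ c ℤ.- d ∣
  ·r^-unique {x} {c} {d} {m} (expansion {w} w∈ x≡c) (expansion {w′} w′∈ x≡d) =
    r*w≡c⇒p∣c (c ℤ.- d) (∈-+ w′∈ (∈-neg w∈)) (begin
      r * (w′ - w)                          ≡⟨ rearrange (ι d) r w w′ ⟩
      ((ι d + r * w′) - r * w) - ι d        ≡⟨ cong (λ t → (t - r * w) - ι d) (sym same-tail) ⟩
      ((ι c + r * w) - r * w) - ι d         ≡⟨ cancel (ι c) (r * w) (ι d) ⟩
      ι c + - ι d                           ≡⟨ cong (_+_ (ι c)) (ι-neg d) ⟩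
      ι c + ι (ℤ.- d)                       ≡⟨ ι-+ c (ℤ.- d) ⟩
      ι (c ℤ.- d)                           ∎)
    where
    open ≡-Reasoning
    rearrange : ∀ d r w w′ → r * (w′ - w) ≡ ((d + r * w′) - r * w) - d
    rearrange = solve 4 (λ d r w w′ → r :* (w′ :- w) := ((d :+ r :* w′) :- r :* w) :- d) refl
    cancel : ∀ a b d → ((a + b) - b) - d ≡ a + - d
    cancel = solve 3 (λ a b d → ((a :+ b) :- b) :- d := a :+ :- d) refl
    same-tail : ι c + r * w ≡ ι d + r * w′
    same-tail = *-cancelˡ-pos (^ℤ-pos 0<r m) (trans (sym x≡c) x≡d)

  ·r^-+ : ∀ {x y c d m} → x ≡ c ·r^ m → y ≡ d ·r^ m → x + y ≡ (c ℤ.+ d) ·r^ m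
  ·r^-+ {c = c} {d} {m} (expansion {w} w∈ refl) (expansion {w′} w′∈ refl) =
    expansion (∈-+ w∈ w′∈)
      (trans (collect (r ^ℤ m) (ι c) (ι d) r w w′) (cong (λ t → r ^ℤ m * (t + r * (w + w′))) (ι-+ c d)))
    where
    collect : ∀ R c d r w w′ → R * (c + r * w) + R * (d + r * w′) ≡ R * ((c + d) + r * (w + w′))
    collect = solve 6 (λ R c d r w w′ → R :* (c :+ r :* w) :+ R :* (d :+ r :* w′) := R :* ((c :+ d) :+ r :* (w :+ w′))) refl

  ·r^-neg : ∀ {x c m} → x ≡ c ·r^ m → - x ≡ ℤ.- c ·r^ m
  ·r^-neg {c = c} {m} (expansion {w} w∈ refl) =
    expansion (∈-neg w∈) (trans (negate (r ^ℤ m) (ι c) r w) (cong (λ t → r ^ℤ m * (t + r * - w)) (ι-neg c)))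
    where
    negate : ∀ R c r w → - (R * (c + r * w)) ≡ R * (- c + r * - w)
    negate = solve 4 (λ R c r w → :- (R :* (c :+ r :* w)) := R :* (:- c :+ r :* :- w)) refl

  ·r^-* : ∀ {x y c d m n} → x ≡ c ·r^ m → y ≡ d ·r^ n → x * y ≡ (c ℤ.* d) ·r^ (m ℤ.+ n)
  ·r^-* {c = c} {d} {m} {n} (expansion {w} w∈ refl) (expansion {w′} w′∈ refl) =
    expansion (∈-+ (∈-+ (∈-* (∈-ι c) w′∈) (∈-* (∈-ι d) w∈)) (∈-* ∈-r (∈-* w∈ w′∈))) (begin
      r ^ℤ m * (ι c + r * w) * (r ^ℤ n * (ι d + r * w′))
        ≡⟨ expand (r ^ℤ m) (r ^ℤ n) (ι c) (ι d) r w w′ ⟩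
      r ^ℤ m * r ^ℤ n * (ι c * ι d + r * tail)
        ≡⟨ cong₂ (λ s t → s * (t + r * tail)) (sym (^ℤ-+ r≢0 m n)) (ι-* c d) ⟩
      r ^ℤ (m ℤ.+ n) * (ι (c ℤ.* d) + r * tail)  ∎)
    where
    open ≡-Reasoning
    tail : ℚ
    tail = ι c * w′ + ι d * w + r * (w * w′)
    expand : ∀ R S c d r w w′ → R * (c + r * w) * (S * (d + r * w′)) ≡
                                R * S * (c * d + r * (c * w′ + d * w + r * (w * w′)))
    expand = solve 7 (λ R S c d r w w′ → R :* (c :+ r :* w) :* (S :* (d :+ r :* w′)) :=
                                         R :* S :* (c :* d :+ r :* (c :* w′ :+ d :* w :+ r :* (w :* w′)))) refl

  ·r^-lower : ∀ {x c m n} → m ℤ.< n → x ≡ c ·r^ n → x ≡ + 0 ·r^ m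
  ·r^-lower {c = c} {m} m<n (expansion {w} w∈ refl) with i≤j⇒∃[k]j≡i+k (ℤ.i<j⇒suc[i]≤j m<n)
  ... | k , refl = expansion (∈-* (∈-^ℕ k) (∈-+ (∈-ι c) (∈-* ∈-r w∈))) (begin
    r ^ℤ (ℤ.suc m ℤ.+ + k) * (ι c + r * w)        ≡⟨ cong (λ i → r ^ℤ i * (ι c + r * w)) (suc-+ m (+ k)) ⟩
    r ^ℤ (m ℤ.+ + suc k) * (ι c + r * w)          ≡⟨ cong (_* (ι c + r * w)) (^ℤ-+-ℕ r≢0 m (suc k)) ⟩
    r ^ℤ m * (r * r ^ℕ k) * (ι c + r * w)         ≡⟨ regroup (r ^ℤ m) r (r ^ℕ k) (ι c + r * w) ⟩
    r ^ℤ m * (0ℚ + r * (r ^ℕ k * (ι c + r * w)))  ∎)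
    where
    open ≡-Reasoning
    suc-+ : ∀ m k → ℤ.1ℤ ℤ.+ m ℤ.+ k ≡ m ℤ.+ (ℤ.1ℤ ℤ.+ k)
    suc-+ = ℤSolver.solve-∀
    regroup : ∀ R r s t → R * (r * s) * t ≡ R * (0ℚ + r * (s * t))
    regroup = solve 4 (λ R r s t → R :* (r :* s) :* t := R :* (con 0ℚ :+ r :* (s :* t))) refl

  r^≡1·r^ : ∀ m → r ^ℤ m ≡ + 1 ·r^ m
  r^≡1·r^ m = expansion (∈-ι (+ 0)) (unit (r ^ℤ m) r)
    where
    unit : ∀ R r → R ≡ R * (1ℚ + r * 0ℚ)
    unit = solve 2 (λ R r → R := R :* (con 1ℚ :+ r :* con 0ℚ)) refl

  r^≡0·r^ : ∀ {m n} → m ℤ.< n → r ^ℤ n ≡ + 0 ·r^ m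
  r^≡0·r^ {n = n} m<n = ·r^-lower m<n (r^≡1·r^ n)

  0·r^-*ʳ : ∀ {x y m} → x ≡ + 0 ·r^ m → y ∈ℤ[1/q] → x * y ≡ + 0 ·r^ m
  0·r^-*ʳ {y = y} {m} (expansion {w} w∈ refl) y∈ = expansion (∈-* w∈ y∈) (shift (r ^ℤ m) r w y)
    where
    shift : ∀ R r w y → R * (0ℚ + r * w) * y ≡ R * (0ℚ + r * (w * y))
    shift = solve 4 (λ R r w y → R :* (con 0ℚ :+ r :* w) :* y := R :* (con 0ℚ :+ r :* (w :* y))) refl

  0·r^-*ˡ : ∀ {x y m} → x ∈ℤ[1/q] → y ≡ + 0 ·r^ m → x * y ≡ + 0 ·r^ m
  0·r^-*ˡ {x} {y} {m} x∈ y≡0 = subst (_≡ + 0 ·r^ m) (*-comm y x) (0·r^-*ʳ y≡0 x∈)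

  powerSum : List ℤ → ℚ
  powerSum []       = 0ℚ
  powerSum (x ∷ xs) = r ^ℤ x + powerSum xs

  powerSum-remove : ∀ m xs → powerSum xs ≡ ι (+ count m xs) * r ^ℤ m + powerSum (remove m xs)
  powerSum-remove m []       = sym (trans (+-identityʳ _) (*-zeroˡ (r ^ℤ m)))
  powerSum-remove m (x ∷ xs) with m ℤ.≟ x
  ... | yes refl = begin
    r ^ℤ m + powerSum xs                                 ≡⟨ cong (_+_ (r ^ℤ m)) (powerSum-remove m xs) ⟩
    r ^ℤ m + (ι (+ count m xs) * r ^ℤ m + powerSum rest) ≡⟨ gather (r ^ℤ m) (ι (+ count m xs)) (powerSum rest) ⟩
    (1ℚ + ι (+ count m xs)) * r ^ℤ m + powerSum rest     ≡⟨ cong (λ c → c * r ^ℤ m + powerSum rest) (sym (ι-suc (count m xs))) ⟩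
    ι (+ suc (count m xs)) * r ^ℤ m + powerSum rest      ∎
    where
    open ≡-Reasoning
    rest : List ℤ
    rest = remove m xs
    gather : ∀ R c s → R + (c * R + s) ≡ (1ℚ + c) * R + s
    gather = solve 3 (λ R c s → R :+ (c :* R :+ s) := (con 1ℚ :+ c) :* R :+ s) refl
  ... | no _ = trans (cong (_+_ (r ^ℤ x)) (powerSum-remove m xs))
                     (swap (r ^ℤ x) (ι (+ count m xs) * r ^ℤ m) (powerSum (remove m xs)))
    where
    swap : ∀ a b c → a + (b + c) ≡ b + (a + c)
    swap = solve 3 (λ a b c → a :+ (b :+ c) := b :+ (a :+ c)) refl

  powerSum≡count·r^ : ∀ {m} xs → All (m ℤ.≤_) xs → powerSum xs ≡ + count m xs ·r^ m
  powerSum≡count·r^ {m} []       [] = expansion (∈-ι (+ 0)) (vanish (r ^ℤ m) r)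
    where
    vanish : ∀ R r → 0ℚ ≡ R * (0ℚ + r * 0ℚ)
    vanish = solve 2 (λ R r → con 0ℚ := R :* (con 0ℚ :+ r :* con 0ℚ)) refl
  powerSum≡count·r^ {m} (x ∷ xs) (m≤x ∷ m≤xs) with m ℤ.≟ x
  ... | yes refl = ·r^-+ (r^≡1·r^ m) (powerSum≡count·r^ xs m≤xs)
  ... | no  m≢x  = ·r^-+ (r^≡0·r^ (ℤ.≤∧≢⇒< m≤x m≢x)) (powerSum≡count·r^ xs m≤xs)

  length·r^≤powerSum : ∀ {m} xs → All (m ℤ.≤_) xs → ι (+ length xs) * r ^ℤ m ≤ powerSum xs
  length·r^≤powerSum {m} []       []           = ≤-reflexive (*-zeroˡ (r ^ℤ m))
  length·r^≤powerSum {m} (x ∷ xs) (m≤x ∷ m≤xs) = begin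
    ι (+ suc (length xs)) * r ^ℤ m           ≡⟨ cong (_* r ^ℤ m) (ι-suc (length xs)) ⟩
    (1ℚ + ι (+ length xs)) * r ^ℤ m          ≡⟨ *-distribʳ-+ (r ^ℤ m) 1ℚ (ι (+ length xs)) ⟩
    1ℚ * r ^ℤ m + ι (+ length xs) * r ^ℤ m   ≤⟨ +-mono-≤ (≤-reflexive (*-identityˡ (r ^ℤ m))) (length·r^≤powerSum xs m≤xs) ⟩
    r ^ℤ m + powerSum xs                     ≤⟨ +-monoˡ-≤ (powerSum xs) (^ℤ-mono-≤ 1<r m≤x) ⟩
    r ^ℤ x + powerSum xs                     ∎
    where open ≤-Reasoning

  length·r^<powerSum : ∀ {m} xs → 0 ℕ.< length xs → All (m ℤ.<_) xs → ι (+ length xs) * r ^ℤ m < powerSum xs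
  length·r^<powerSum {m} xs 0<n m<xs = begin-strict
    ι (+ length xs) * r ^ℤ m          <⟨ x<x*y (*-pos (ι-pos 0<n) (^ℤ-pos 0<r m)) 1<r ⟩
    ι (+ length xs) * r ^ℤ m * r      ≡⟨ *-assoc (ι (+ length xs)) (r ^ℤ m) r ⟩
    ι (+ length xs) * (r ^ℤ m * r)    ≡⟨ cong (ι (+ length xs) *_) (sym (^ℤ-suc r≢0 m)) ⟩
    ι (+ length xs) * r ^ℤ ℤ.suc m    ≤⟨ length·r^≤powerSum xs (All.map ℤ.i<j⇒suc[i]≤j m<xs) ⟩
    powerSum xs                       ∎
    where open ≤-Reasoning

  remove-minimum : ∀ {m} xs → All (m ℤ.≤_) xs → All (m ℤ.<_) (remove m xs)
  remove-minimum     []       []           = []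
  remove-minimum {m} (x ∷ xs) (m≤x ∷ m≤xs) with m ℤ.≟ x
  ... | yes _   = remove-minimum xs m≤xs
  ... | no  m≢x = ℤ.≤∧≢⇒< m≤x m≢x ∷ remove-minimum xs m≤xs

  -- Only the extreme case cx = 0, cy = n survives the divisibility by p, and then
  -- Σ xs ≥ n rᵐ⁺¹ exceeds Σ ys = n rᵐ.
  lowest-count-≮ : ∀ {m} xs ys → All (m ℤ.≤_) xs → All (m ℤ.≤_) ys →
                   length xs ≡ length ys → length ys ℕ.≤ p → powerSum xs ≡ powerSum ys →
                   ¬ (count m xs ℕ.< count m ys)
  lowest-count-≮ {m} xs ys m≤xs m≤ys |xs|≡|ys| |ys|≤p Σxs≡Σys cx<cy =
    <-irrefl (sym (trans Σxs′≡Σxs (trans Σxs≡Σys Σys≡n·r^m)))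
             (length·r^<powerSum xs′ 0<|xs′| (remove-minimum xs m≤xs))
    where
    cx cy : ℕ
    cx = count m xs
    cy = count m ys
    xs′ : List ℤ
    xs′ = remove m xs
    p∣gap : p ∣ cy ∸ cx
    p∣gap = subst (p ∣_) |cx-cy|≡gap
      (·r^-unique (subst (_≡ + cx ·r^ m) Σxs≡Σys (powerSum≡count·r^ xs m≤xs)) (powerSum≡count·r^ ys m≤ys))
      where
      |cx-cy|≡gap : ℤ.∣ + cx ℤ.- + cy ∣ ≡ cy ∸ cx
      |cx-cy|≡gap = trans (cong ℤ.∣_∣ (trans (ℤ.m-n≡m⊖n cx cy) (ℤ.⊖-< cx<cy))) (ℤ.∣-i∣≡∣i∣ (+ (cy ∸ cx)))
    extremes : cx ≡ 0 × cy ≡ length ys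
    extremes = divisible-gap⇒extremes p∣gap cx<cy (count≤length m ys) |ys|≤p
    |xs′|≡cy : length xs′ ≡ cy
    |xs′|≡cy = begin
      length xs′              ≡⟨ sym (ℕ.+-identityʳ _) ⟩
      length xs′ ℕ.+ 0        ≡⟨ cong (length xs′ ℕ.+_) (sym (proj₁ extremes)) ⟩
      length xs′ ℕ.+ cx       ≡⟨ length-remove m xs ⟩
      length xs               ≡⟨ trans |xs|≡|ys| (sym (proj₂ extremes)) ⟩
      cy                      ∎
      where open ≡-Reasoning
    0<|xs′| : 0 ℕ.< length xs′
    0<|xs′| = subst (0 ℕ.<_) (sym |xs′|≡cy) (ℕ.≤-trans (ℕ.s≤s ℕ.z≤n) cx<cy)
    Σys≡n·r^m : powerSum ys ≡ ι (+ length xs′) * r ^ℤ m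
    Σys≡n·r^m = begin
      powerSum ys                                   ≡⟨ powerSum-remove m ys ⟩
      ι (+ cy) * r ^ℤ m + powerSum (remove m ys)    ≡⟨ cong (λ zs → ι (+ cy) * r ^ℤ m + powerSum zs) ys′≡[] ⟩
      ι (+ cy) * r ^ℤ m + 0ℚ                        ≡⟨ +-identityʳ _ ⟩
      ι (+ cy) * r ^ℤ m                             ≡⟨ cong (λ k → ι (+ k) * r ^ℤ m) (sym |xs′|≡cy) ⟩
      ι (+ length xs′) * r ^ℤ m                     ∎
      where
      open ≡-Reasoning
      ys′≡[] : remove m ys ≡ []
      ys′≡[] = count≡length⇒remove≡[] m ys (proj₂ extremes)
    Σxs′≡Σxs : powerSum xs′ ≡ powerSum xs
    Σxs′≡Σxs = sym (begin
      powerSum xs                              ≡⟨ powerSum-remove m xs ⟩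
      ι (+ cx) * r ^ℤ m + powerSum xs′         ≡⟨ cong (λ k → ι (+ k) * r ^ℤ m + powerSum xs′) (proj₁ extremes) ⟩
      0ℚ * r ^ℤ m + powerSum xs′               ≡⟨ cong (_+ powerSum xs′) (*-zeroˡ (r ^ℤ m)) ⟩
      0ℚ + powerSum xs′                        ≡⟨ +-identityˡ _ ⟩
      powerSum xs′                             ∎)
      where open ≡-Reasoning

  lowest-count : ∀ {m} xs ys → All (m ℤ.≤_) xs → All (m ℤ.≤_) ys →
                 length xs ≡ length ys → length xs ℕ.≤ p → powerSum xs ≡ powerSum ys →
                 count m xs ≡ count m ys
  lowest-count {m} xs ys m≤xs m≤ys |xs|≡|ys| |xs|≤p Σxs≡Σys with ℕ.<-cmp (count m xs) (count m ys)
  ... | tri< cx<cy _ _ = contradiction cx<cy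
          (lowest-count-≮ xs ys m≤xs m≤ys |xs|≡|ys| (subst (ℕ._≤ p) |xs|≡|ys| |xs|≤p) Σxs≡Σys)
  ... | tri≈ _ cx≡cy _ = cx≡cy
  ... | tri> _ _ cy<cx = contradiction cy<cx
          (lowest-count-≮ ys xs m≤ys m≤xs (sym |xs|≡|ys|) |xs|≤p (sym Σxs≡Σys))

  lowest-removed : ∀ {m} xs ys → All (m ℤ.≤_) xs → All (m ℤ.≤_) ys →
                   length xs ≡ length ys → length xs ℕ.≤ p → powerSum xs ≡ powerSum ys →
                   count m xs ≡ count m ys × powerSum (remove m xs) ≡ powerSum (remove m ys)
  lowest-removed {m} xs ys m≤xs m≤ys |xs|≡|ys| |xs|≤p Σxs≡Σys =
    cx≡cy , ℚ+.∙-cancelˡ (ι (+ count m xs) * r ^ℤ m) _ _ (begin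
      ι (+ count m xs) * r ^ℤ m + powerSum (remove m xs)   ≡⟨ sym (powerSum-remove m xs) ⟩
      powerSum xs                                          ≡⟨ Σxs≡Σys ⟩
      powerSum ys                                          ≡⟨ powerSum-remove m ys ⟩
      ι (+ count m ys) * r ^ℤ m + powerSum (remove m ys)   ≡⟨ cong (λ c → ι (+ c) * r ^ℤ m + powerSum (remove m ys)) (sym cx≡cy) ⟩
      ι (+ count m xs) * r ^ℤ m + powerSum (remove m ys)   ∎)
    where
    open ≡-Reasoning
    cx≡cy : count m xs ≡ count m ys
    cx≡cy = lowest-count xs ys m≤xs m≤ys |xs|≡|ys| |xs|≤p Σxs≡Σys

  powerSum-unique-bounded : ∀ k xs ys → length xs ℕ.≤ k → length xs ≡ length ys → length xs ℕ.≤ p →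
                            powerSum xs ≡ powerSum ys → xs ≈ᵇ ys
  powerSum-unique-bounded _       []       []       _ _ _ _ = same-counts λ _ → refl
  powerSum-unique-bounded (suc k) (x ∷ xs) ys (ℕ.s≤s |xs|≤k) |x∷xs|≡|ys| |x∷xs|≤p Σx∷xs≡Σys =
    ≈ᵇ-remove m (x ∷ xs) ys cx≡cy (powerSum-unique-bounded k (remove m (x ∷ xs)) (remove m ys)
      |xs′|≤k |xs′|≡|ys′| (ℕ.≤-trans (length-remove≤ m (x ∷ xs)) |x∷xs|≤p) Σxs′≡Σys′)
    where
    m : ℤ
    m = min x (xs ++ ys)
    m≤x∷xs++ys : All (m ℤ.≤_) (x ∷ xs ++ ys)
    m≤x∷xs++ys = min≤⊤ x (xs ++ ys) ∷ min≤xs x (xs ++ ys)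
    m∈x∷xs++ys : m ∈ x ∷ xs ++ ys
    m∈x∷xs++ys = [ here , there ]′ (argmin-sel id x (xs ++ ys))
    removed : count m (x ∷ xs) ≡ count m ys × powerSum (remove m (x ∷ xs)) ≡ powerSum (remove m ys)
    removed = lowest-removed (x ∷ xs) ys (All.++⁻ˡ (x ∷ xs) m≤x∷xs++ys) (All.++⁻ʳ (x ∷ xs) m≤x∷xs++ys)
                |x∷xs|≡|ys| |x∷xs|≤p Σx∷xs≡Σys
    cx≡cy : count m (x ∷ xs) ≡ count m ys
    cx≡cy = proj₁ removed
    Σxs′≡Σys′ : powerSum (remove m (x ∷ xs)) ≡ powerSum (remove m ys)
    Σxs′≡Σys′ = proj₂ removed
    0<cx : 0 ℕ.< count m (x ∷ xs)
    0<cx = positive-half (subst (0 ℕ.<_) (count-++ m (x ∷ xs) ys) (∈⇒0<count m∈x∷xs++ys)) cx≡cy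
      where
      positive-half : ∀ {a b} → 0 ℕ.< a ℕ.+ b → a ≡ b → 0 ℕ.< a
      positive-half {suc _} _  _    = ℕ.s≤s ℕ.z≤n
      positive-half {zero}  () refl
    |xs′|≤k : length (remove m (x ∷ xs)) ℕ.≤ k
    |xs′|≤k = ℕ.≤-trans (ℕ.m<1+n⇒m≤n (length-remove< m (x ∷ xs) 0<cx)) |xs|≤k
    |xs′|≡|ys′| : length (remove m (x ∷ xs)) ≡ length (remove m ys)
    |xs′|≡|ys′| = ℕ.+-cancelʳ-≡ (count m ys) _ _ (begin
      length (remove m (x ∷ xs)) ℕ.+ count m ys        ≡⟨ cong (length (remove m (x ∷ xs)) ℕ.+_) (sym cx≡cy) ⟩
      length (remove m (x ∷ xs)) ℕ.+ count m (x ∷ xs)  ≡⟨ length-remove m (x ∷ xs) ⟩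
      length (x ∷ xs)                                  ≡⟨ |x∷xs|≡|ys| ⟩
      length ys                                        ≡⟨ sym (length-remove m ys) ⟩
      length (remove m ys) ℕ.+ count m ys              ∎)
      where open ≡-Reasoning

  powerSum-unique : ∀ xs ys → length xs ≡ length ys → length xs ℕ.≤ p → powerSum xs ≡ powerSum ys → xs ≈ᵇ ys
  powerSum-unique xs ys = powerSum-unique-bounded (length xs) xs ys ℕ.≤-refl

  f g : ℕ → ℚ
  f n = r ^ℕ suc n - 1ℚ
  g n = r ^ℕ n + 1ℚ

  f-pos : ∀ n → 0ℚ < f n
  f-pos n = subst (_< f n) (+-inverseʳ 1ℚ) (+-monoˡ-< (- 1ℚ) (1<^ℕ-suc 1<r n))

  g-pos : ∀ n → 0ℚ < g n
  g-pos n = <-≤-trans (positive⁻¹ 1ℚ) (subst (_≤ g n) (+-identityˡ 1ℚ) (+-monoˡ-≤ 1ℚ (<⇒≤ (^ℕ-pos 0<r n))))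

  f-strictMono : Monotonic₁ ℕ._<_ _<_ f
  f-strictMono m<n = +-monoˡ-< (- 1ℚ) (^ℕ-strictMono 1<r (ℕ.s≤s m<n))

  g-strictMono : Monotonic₁ ℕ._<_ _<_ g
  g-strictMono m<n = +-monoˡ-< 1ℚ (^ℕ-strictMono 1<r m<n)

  ∈-f : ∀ n → f n ∈ℤ[1/q]
  ∈-f n = ∈-+ (∈-^ℕ (suc n)) (∈-neg (∈-ι (+ 1)))

  ∈-g : ∀ n → g n ∈ℤ[1/q]
  ∈-g n = ∈-+ (∈-^ℕ n) (∈-ι (+ 1))

  r^suc≡0·r^0 : ∀ n → r ^ℕ suc n ≡ + 0 ·r^ + 0
  r^suc≡0·r^0 n = r^≡0·r^ (ℤ.+<+ (ℕ.s≤s (ℕ.z≤n {n})))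

  f≡-1·r^0 : ∀ n → f n ≡ -[1+ 0 ] ·r^ + 0
  f≡-1·r^0 n = ·r^-+ (r^suc≡0·r^0 n) (·r^-neg (r^≡1·r^ (+ 0)))

  g0≡2·r^0 : g 0 ≡ + 2 ·r^ + 0
  g0≡2·r^0 = ·r^-+ (r^≡1·r^ (+ 0)) (r^≡1·r^ (+ 0))

  g-suc≡1·r^0 : ∀ n → g (suc n) ≡ + 1 ·r^ + 0
  g-suc≡1·r^0 n = ·r^-+ (r^suc≡0·r^0 n) (r^≡1·r^ (+ 0))

  f-no-shift : ∀ A D A′ D′ k → f A * (r ^ℕ suc k * f D′) ≢ f A′ * f D
  f-no-shift A D A′ D′ k E = p∤1 (·r^-unique (subst (_≡ + 0 ·r^ + 0) E lhs) rhs)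
    where
    lhs : f A * (r ^ℕ suc k * f D′) ≡ + 0 ·r^ + 0
    lhs = 0·r^-*ˡ (∈-f A) (0·r^-*ʳ (r^suc≡0·r^0 k) (∈-f D′))
    rhs : f A′ * f D ≡ + 1 ·r^ + 0
    rhs = ·r^-* (f≡-1·r^0 A′) (f≡-1·r^0 D)

  g0≤g : ∀ n → g 0 ≤ g n
  g0≤g n = +-monoˡ-≤ 1ℚ (1≤^ℕ 1<r n)

  g0*g0<g*r^suc*g : ∀ A D′ k → g 0 * g 0 < g A * (r ^ℕ suc k * g D′)
  g0*g0<g*r^suc*g A D′ k = begin-strict
    g 0 * g 0                    ≤⟨ *-monoʳ-≤-nonNeg (g 0) {{nonNegative (<⇒≤ (g-pos 0))}} (g0≤g A) ⟩
    g A * g 0                    <⟨ *-monoʳ-<-pos (g A) {{positive (g-pos A)}} g0<r^suc*g ⟩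
    g A * (r ^ℕ suc k * g D′)    ∎
    where
    open ≤-Reasoning
    g0<r^suc*g : g 0 < r ^ℕ suc k * g D′
    g0<r^suc*g = begin-strict
      g 0                  ≤⟨ g0≤g D′ ⟩
      g D′                 <⟨ x<x*y (g-pos D′) (1<^ℕ-suc 1<r k) ⟩
      g D′ * r ^ℕ suc k    ≡⟨ *-comm (g D′) _ ⟩
      r ^ℕ suc k * g D′    ∎

  -- When A′ = D = 0 the right-hand side has constant term 4, which p may divide.
  g-no-shift : 3 ℕ.≤ p → ∀ A D A′ D′ k → g A * (r ^ℕ suc k * g D′) ≢ g A′ * g D
  g-no-shift 3≤p A D A′ D′ k E = excluded A′ D E (subst (_≡ + 0 ·r^ + 0) E lhs)
    where
    p∤2 : ¬ p ∣ 2
    p∤2 p∣2 = ℕ.<⇒≱ 3≤p (∣⇒≤ p∣2)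
    lhs : g A * (r ^ℕ suc k * g D′) ≡ + 0 ·r^ + 0
    lhs = 0·r^-*ˡ (∈-g A) (0·r^-*ʳ (r^suc≡0·r^0 k) (∈-g D′))
    excluded : ∀ A′ D → g A * (r ^ℕ suc k * g D′) ≡ g A′ * g D → g A′ * g D ≡ + 0 ·r^ + 0 → ⊥
    excluded zero    zero    E _     = <-irrefl (sym E) (g0*g0<g*r^suc*g A D′ k)
    excluded zero    (suc d) _ rhs≡0 = p∤2 (·r^-unique rhs≡0 (·r^-* g0≡2·r^0 (g-suc≡1·r^0 d)))
    excluded (suc a) zero    _ rhs≡0 = p∤2 (·r^-unique rhs≡0 (·r^-* (g-suc≡1·r^0 a) g0≡2·r^0))
    excluded (suc a) (suc d) _ rhs≡0 = p∤1 (·r^-unique rhs≡0 (·r^-* (g-suc≡1·r^0 a) (g-suc≡1·r^0 d)))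

  -- Expanded, both sides have the same constant term, and the next lowest power of r,
  -- rᴬ⁺¹ for f and rᴬ for g, occurs on the left only.
  f-cross : ∀ {A D A′ D′} → A ℕ.< D → A ℕ.< A′ → D ℕ.< D′ → f A * f D′ ≢ f A′ * f D
  f-cross {A} {D} {A′} {D′} A<D A<A′ D<D′ E =
    p∤1 (·r^-unique (subst (_≡ -[1+ 0 ] ·r^ m) (expand (r ^ℕ suc A) (r ^ℕ suc D′)) lhs)
                    (subst (_≡ + 0 ·r^ m) (trans (expand (r ^ℕ suc A′) (r ^ℕ suc D)) (cong (_- 1ℚ) (sym E))) rhs))
    where
    m : ℤ
    m = + suc A
    expand : ∀ x y → x * y - x - y ≡ (x - 1ℚ) * (y - 1ℚ) - 1ℚ
    expand = solve 2 (λ x y → x :* y :- x :- y := (x :- con 1ℚ) :* (y :- con 1ℚ) :- con 1ℚ) refl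
    above : ∀ {n} → A ℕ.< n → r ^ℕ suc n ≡ + 0 ·r^ m
    above A<n = r^≡0·r^ (ℤ.+<+ (ℕ.s≤s A<n))
    A<D′ : A ℕ.< D′
    A<D′ = ℕ.<-trans A<D D<D′
    lhs : r ^ℕ suc A * r ^ℕ suc D′ - r ^ℕ suc A - r ^ℕ suc D′ ≡ -[1+ 0 ] ·r^ m
    lhs = ·r^-+ (·r^-+ (0·r^-*ˡ (∈-^ℕ (suc A)) (above A<D′)) (·r^-neg (r^≡1·r^ m))) (·r^-neg (above A<D′))
    rhs : r ^ℕ suc A′ * r ^ℕ suc D - r ^ℕ suc A′ - r ^ℕ suc D ≡ + 0 ·r^ m
    rhs = ·r^-+ (·r^-+ (0·r^-*ˡ (∈-^ℕ (suc A′)) (above A<D)) (·r^-neg (above A<A′))) (·r^-neg (above A<D))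

  g-cross : ∀ {A D A′ D′} → A ℕ.< D → A ℕ.< A′ → D ℕ.< D′ → g A * g D′ ≢ g A′ * g D
  g-cross {A} {D} {A′} {D′} A<D A<A′ D<D′ E =
    p∤1 (·r^-unique (subst (_≡ + 1 ·r^ m) (expand (r ^ℕ A) (r ^ℕ D′)) lhs)
                    (subst (_≡ + 0 ·r^ m) (trans (expand (r ^ℕ A′) (r ^ℕ D)) (cong (_- 1ℚ) (sym E))) rhs))
    where
    m : ℤ
    m = + A
    expand : ∀ x y → x * y + x + y ≡ (x + 1ℚ) * (y + 1ℚ) - 1ℚ
    expand = solve 2 (λ x y → x :* y :+ x :+ y := (x :+ con 1ℚ) :* (y :+ con 1ℚ) :- con 1ℚ) refl
    above : ∀ {n} → A ℕ.< n → r ^ℕ n ≡ + 0 ·r^ m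
    above A<n = r^≡0·r^ (ℤ.+<+ A<n)
    A<D′ : A ℕ.< D′
    A<D′ = ℕ.<-trans A<D D<D′
    lhs : r ^ℕ A * r ^ℕ D′ + r ^ℕ A + r ^ℕ D′ ≡ + 1 ·r^ m
    lhs = ·r^-+ (·r^-+ (0·r^-*ˡ (∈-^ℕ A) (above A<D′)) (r^≡1·r^ m)) (above A<D′)
    rhs : r ^ℕ A′ * r ^ℕ D + r ^ℕ A′ + r ^ℕ D ≡ + 0 ·r^ m
    rhs = ·r^-+ (·r^-+ (0·r^-*ˡ (∈-^ℕ A′) (above A<D)) (above A<A′)) (above A<D)

  -- Uniqueness of normalised solutions F A = rᶜ F D z

  z*r^≢r^ : ∀ {z} → (∀ n → z ≢ r ^ℤ n) → ∀ c e → z * r ^ℤ c ≢ r ^ℤ e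
  z*r^≢r^ {z} z∉r^ℤ c e zrᶜ≡rᵉ = z∉r^ℤ (e ℤ.- c) (*-cancelˡ-pos (^ℤ-pos 0<r c) (begin
    r ^ℤ c * z                    ≡⟨ *-comm (r ^ℤ c) z ⟩
    z * r ^ℤ c                    ≡⟨ zrᶜ≡rᵉ ⟩
    r ^ℤ e                        ≡⟨ cong (r ^ℤ_) (minus-plus e c) ⟩
    r ^ℤ ((e ℤ.- c) ℤ.+ c)        ≡⟨ ^ℤ-+ r≢0 (e ℤ.- c) c ⟩
    r ^ℤ (e ℤ.- c) * r ^ℤ c       ≡⟨ *-comm _ (r ^ℤ c) ⟩
    r ^ℤ c * r ^ℤ (e ℤ.- c)       ∎))
    where
    open ≡-Reasoning
    minus-plus : ∀ e c → e ≡ (e ℤ.- c) ℤ.+ c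
    minus-plus = ℤSolver.solve-∀

  module Representations
    (F : ℕ → ℚ) (F-pos : ∀ n → 0ℚ < F n) (F-strictMono : Monotonic₁ ℕ._<_ _<_ F)
    (no-shift : ∀ A D A′ D′ k → F A * (r ^ℕ suc k * F D′) ≢ F A′ * F D)
    (cross : ∀ {A D A′ D′} → A ℕ.< D → A ℕ.< A′ → D ℕ.< D′ → F A * F D′ ≢ F A′ * F D)
    where

    cross-≢ : ∀ {A D A′ D′} → A ≢ D → A ℕ.< A′ → D ℕ.< D′ → F A * F D′ ≢ F A′ * F D
    cross-≢ {A} {D} {A′} {D′} A≢D A<A′ D<D′ E with ℕ.<-cmp A D
    ... | tri< A<D _ _ = cross A<D A<A′ D<D′ E
    ... | tri≈ _ A≡D _ = A≢D A≡D
    ... | tri> _ _ D<A = cross D<A D<D′ A<A′ (trans (*-comm (F D) (F A′)) (trans (sym E) (*-comm (F A) (F D′))))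

    balanced : ∀ {A D A′ D′} → A ≢ D → A′ ≢ D′ → F A * F D′ ≡ F A′ * F D → A ≡ A′ × D ≡ D′
    balanced {A} {D} {A′} {D′} A≢D A′≢D′ E with ℕ.<-cmp A A′ | ℕ.<-cmp D D′
    ... | tri≈ _ refl _ | _ = refl , sym (strictMono⇒injective F-strictMono (*-cancelˡ-pos (F-pos A) E))
    ... | _ | tri≈ _ refl _ =
      strictMono⇒injective F-strictMono (*-cancelˡ-pos (F-pos D) (trans (*-comm (F D) (F A)) (trans E (*-comm (F A′) (F D))))) , refl
    ... | tri< A<A′ _ _ | tri< D<D′ _ _ = contradiction E (cross-≢ A≢D A<A′ D<D′)
    ... | tri> _ _ A′<A | tri> _ _ D′<D = contradiction (sym E) (cross-≢ A′≢D′ A′<A D′<D)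
    ... | tri< A<A′ _ _ | tri> _ _ D′<D =
      contradiction E (<⇒≢ (*-strictMono (F-pos A) (F-strictMono A<A′) (F-pos D′) (F-strictMono D′<D)))
    ... | tri> _ _ A′<A | tri< D<D′ _ _ =
      contradiction (sym E) (<⇒≢ (*-strictMono (F-pos A′) (F-strictMono A′<A) (F-pos D) (F-strictMono D<D′)))

    unshifted : ∀ {A D A′ D′} k → F A * (r ^ℕ k * F D′) ≡ F A′ * F D → k ≡ 0
    unshifted                   zero    _ = refl
    unshifted {A} {D} {A′} {D′} (suc k) E = contradiction E (no-shift A D A′ D′ k)

    module _ {z : ℚ} (z∉r^ℤ : ∀ n → z ≢ r ^ℤ n) where

      Rep : ℕ → ℕ → ℤ → Set
      Rep A D c = F A ≡ (r ^ℤ c * F D) * z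

      rep-≢ : ∀ {A D} c → Rep A D c → A ≢ D
      rep-≢ {A} c rep refl = z*r^≢r^ z∉r^ℤ c (+ 0) (*-cancelˡ-pos (F-pos A) (begin
        F A * (z * r ^ℤ c)        ≡⟨ ℚ*.x∙yz≈zx∙y (F A) z (r ^ℤ c) ⟩
        (r ^ℤ c * F A) * z        ≡⟨ sym rep ⟩
        F A                       ≡⟨ sym (*-identityʳ (F A)) ⟩
        F A * 1ℚ                  ∎))
        where
        open ≡-Reasoning

      cross-multiplied : ∀ {A D A′ D′} c k → Rep A D c → Rep A′ D′ (c ℤ.+ + k) → F A * (r ^ℕ k * F D′) ≡ F A′ * F D
      cross-multiplied {A} {D} {A′} {D′} c k rep rep′ = *-cancelˡ-pos (^ℤ-pos 0<r c) (begin
        r ^ℤ c * (F A * (r ^ℕ k * F D′))                ≡⟨ regroup (r ^ℤ c) (r ^ℕ k) (F A) (F D′) ⟩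
        F A * ((r ^ℤ c * r ^ℕ k) * F D′)                ≡⟨ cong (λ t → F A * (t * F D′)) (sym (^ℤ-+-ℕ r≢0 c k)) ⟩
        F A * (Rᶜ′ * F D′)                              ≡⟨ cong (_* (Rᶜ′ * F D′)) rep ⟩
        ((r ^ℤ c * F D) * z) * (Rᶜ′ * F D′)             ≡⟨ ℚ*.xy∙z≈zy∙x (r ^ℤ c * F D) z (Rᶜ′ * F D′) ⟩
        ((Rᶜ′ * F D′) * z) * (r ^ℤ c * F D)             ≡⟨ cong (_* (r ^ℤ c * F D)) (sym rep′) ⟩
        F A′ * (r ^ℤ c * F D)                           ≡⟨ ℚ*.x∙yz≈y∙xz (F A′) (r ^ℤ c) (F D) ⟩
        r ^ℤ c * (F A′ * F D)                           ∎)
        where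
        open ≡-Reasoning
        Rᶜ′ : ℚ
        Rᶜ′ = r ^ℤ (c ℤ.+ + k)
        regroup : ∀ R K a b → R * (a * (K * b)) ≡ a * ((R * K) * b)
        regroup = solve 4 (λ R K a b → R :* (a :* (K :* b)) := a :* ((R :* K) :* b)) refl

      rep-unique-≤ : ∀ {A D c A′ D′ c′} → c ℤ.≤ c′ → Rep A D c → Rep A′ D′ c′ → A ≡ A′ × D ≡ D′ × c ≡ c′
      rep-unique-≤ {A} {D} {c} {A′} {D′} c≤c′ rep rep′ with i≤j⇒∃[k]j≡i+k c≤c′
      ... | k , refl = proj₁ matched , proj₂ matched , c≡c+k
        where
        E : F A * (r ^ℕ k * F D′) ≡ F A′ * F D
        E = cross-multiplied c k rep rep′
        k≡0 : k ≡ 0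
        k≡0 = unshifted k E
        matched : A ≡ A′ × D ≡ D′
        matched = balanced (rep-≢ c rep) (rep-≢ (c ℤ.+ + k) rep′)
          (trans (cong (F A *_) (sym (trans (cong (λ n → r ^ℕ n * F D′) k≡0) (*-identityˡ (F D′))))) E)
        c≡c+k : c ≡ c ℤ.+ + k
        c≡c+k = trans (sym (ℤ.+-identityʳ c)) (cong (λ n → c ℤ.+ + n) (sym k≡0))

      rep-unique : ∀ {A D c A′ D′ c′} → Rep A D c → Rep A′ D′ c′ → A ≡ A′ × D ≡ D′ × c ≡ c′
      rep-unique {c = c} {c′ = c′} rep rep′ with ℤ.≤-total c c′
      ... | inj₁ c≤c′ = rep-unique-≤ c≤c′ rep rep′
      ... | inj₂ c′≤c with rep-unique-≤ c′≤c rep′ rep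
      ...   | refl , refl , refl = refl , refl , refl

  module f-Representations = Representations f f-pos f-strictMono f-no-shift f-cross
  module g-Representations (3≤p : 3 ℕ.≤ p) = Representations g g-pos g-strictMono (g-no-shift 3≤p) g-cross

  normal-form-i : ∀ {a b c} z → + 0 ℤ.≤ a → c ℤ.≤ b → r ^ℤ a + 1ℚ ≡ (r ^ℤ b + r ^ℤ c) * z →
                  ∃[ A ] ∃[ D ] a ≡ + A × b ≡ c ℤ.+ + D × g A ≡ (r ^ℤ c * g D) * z
  normal-form-i {+ A} {b} {c} z _ c≤b E with i≤j⇒∃[k]j≡i+k c≤b
  ... | D , refl = A , D , refl , refl , trans E (cong (_* z) (begin
    r ^ℤ (c ℤ.+ + D) + r ^ℤ c        ≡⟨ cong (_+ r ^ℤ c) (^ℤ-+-ℕ r≢0 c D) ⟩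
    r ^ℤ c * r ^ℕ D + r ^ℤ c         ≡⟨ factor (r ^ℤ c) (r ^ℕ D) ⟩
    r ^ℤ c * g D                     ∎))
    where
    open ≡-Reasoning
    factor : ∀ R x → R * x + R ≡ R * (x + 1ℚ)
    factor = solve 2 (λ R x → R :* x :+ R := R :* (x :+ con 1ℚ)) refl

  normal-form-iii : ∀ {z a} b c → 0ℚ < z → + 0 ℤ.< a → r ^ℤ a - 1ℚ ≡ (r ^ℤ b - r ^ℤ c) * z →
                    ∃[ A ] ∃[ D ] a ≡ + suc A × b ≡ c ℤ.+ + suc D × f A ≡ (r ^ℤ c * f D) * z
  normal-form-iii {a = + zero} _ _ _ (ℤ.+<+ ()) _
  normal-form-iii {z} {+ suc A} b c 0<z _ E with b ℤ.≤? c
  ... | yes b≤c = contradiction (<-≤-trans (f-pos A) (begin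
    f A                         ≡⟨ E ⟩
    (r ^ℤ b - r ^ℤ c) * z       ≤⟨ *-monoʳ-≤-nonNeg z {{nonNegative (<⇒≤ 0<z)}} rᵇ-rᶜ≤0 ⟩
    0ℚ * z                      ≡⟨ *-zeroˡ z ⟩
    0ℚ                          ∎)) (<-irrefl refl)
    where
    open ≤-Reasoning
    rᵇ-rᶜ≤0 : r ^ℤ b - r ^ℤ c ≤ 0ℚ
    rᵇ-rᶜ≤0 = subst (r ^ℤ b - r ^ℤ c ≤_) (+-inverseʳ (r ^ℤ c)) (+-monoˡ-≤ (- r ^ℤ c) (^ℤ-mono-≤ 1<r b≤c))
  ... | no b≰c with i≤j⇒∃[k]j≡i+k (ℤ.i<j⇒suc[i]≤j (ℤ.≰⇒> b≰c))
  ...   | D , refl = A , D , refl , suc-+ c (+ D) , trans E (cong (_* z) (begin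
    r ^ℤ (ℤ.suc c ℤ.+ + D) - r ^ℤ c   ≡⟨ cong (λ i → r ^ℤ i - r ^ℤ c) (suc-+ c (+ D)) ⟩
    r ^ℤ (c ℤ.+ + suc D) - r ^ℤ c     ≡⟨ cong (_- r ^ℤ c) (^ℤ-+-ℕ r≢0 c (suc D)) ⟩
    r ^ℤ c * r ^ℕ suc D - r ^ℤ c      ≡⟨ factor (r ^ℤ c) (r ^ℕ suc D) ⟩
    r ^ℤ c * f D                      ∎))
    where
    open ≡-Reasoning
    suc-+ : ∀ c d → ℤ.1ℤ ℤ.+ c ℤ.+ d ≡ c ℤ.+ (ℤ.1ℤ ℤ.+ d)
    suc-+ = ℤSolver.solve-∀
    factor : ∀ R x → R * x - R ≡ R * (x - 1ℚ)
    factor = solve 2 (λ R x → R :* x :- R := R :* (x :- con 1ℚ)) refl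

  part-i : 3 ℕ.≤ p → ∀ {z} → (∀ n → z ≢ r ^ℤ n) → ∀ a b c a′ b′ c′ →
           + 0 ℤ.≤ a → c ℤ.≤ b → r ^ℤ a + 1ℚ ≡ (r ^ℤ b + r ^ℤ c) * z →
           + 0 ℤ.≤ a′ → c′ ℤ.≤ b′ → r ^ℤ a′ + 1ℚ ≡ (r ^ℤ b′ + r ^ℤ c′) * z →
           a ≡ a′ × b ≡ b′ × c ≡ c′
  part-i 3≤p {z} z∉r^ℤ a b c a′ b′ c′ 0≤a c≤b E 0≤a′ c′≤b′ E′
    with normal-form-i z 0≤a c≤b E | normal-form-i z 0≤a′ c′≤b′ E′
  ... | A , D , refl , refl , rep | A′ , D′ , refl , refl , rep′ =
    conclude (g-Representations.rep-unique 3≤p z∉r^ℤ {A} {D} {c} {A′} {D′} {c′} rep rep′)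
    where
    conclude : ∀ {A D A′ D′ : ℕ} {c c′ : ℤ} → A ≡ A′ × D ≡ D′ × c ≡ c′ →
               + A ≡ + A′ × c ℤ.+ + D ≡ c′ ℤ.+ + D′ × c ≡ c′
    conclude (refl , refl , refl) = refl , refl , refl

  part-iii : ∀ {z} → 0ℚ < z → (∀ n → z ≢ r ^ℤ n) → ∀ a b c a′ b′ c′ →
             + 0 ℤ.< a → r ^ℤ a - 1ℚ ≡ (r ^ℤ b - r ^ℤ c) * z →
             + 0 ℤ.< a′ → r ^ℤ a′ - 1ℚ ≡ (r ^ℤ b′ - r ^ℤ c′) * z →
             a ≡ a′ × b ≡ b′ × c ≡ c′
  part-iii 0<z z∉r^ℤ a b c a′ b′ c′ 0<a E 0<a′ E′
    with normal-form-iii b c 0<z 0<a E | normal-form-iii b′ c′ 0<z 0<a′ E′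
  ... | A , D , refl , refl , rep | A′ , D′ , refl , refl , rep′ =
    conclude (f-Representations.rep-unique z∉r^ℤ {A} {D} {c} {A′} {D′} {c′} rep rep′)
    where
    conclude : ∀ {A D A′ D′ : ℕ} {c c′ : ℤ} → A ≡ A′ × D ≡ D′ × c ≡ c′ →
               + suc A ≡ + suc A′ × c ℤ.+ + suc D ≡ c′ ℤ.+ + suc D′ × c ≡ c′
    conclude (refl , refl , refl) = refl , refl , refl

  ii-b≢0 : ∀ {z} → (∀ n → z ≢ r ^ℤ n) → ∀ a b c → r ^ℤ a + 1ℚ ≡ r ^ℤ b + r ^ℤ c * z → b ≢ + 0
  ii-b≢0 {z} z∉r^ℤ a b c E refl = z*r^≢r^ z∉r^ℤ c a (sym (trans rᵃ≡rᶜz (*-comm (r ^ℤ c) z)))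
    where
    rᵃ≡rᶜz : r ^ℤ a ≡ r ^ℤ c * z
    rᵃ≡rᶜz = ℚ+.∙-cancelˡ 1ℚ (r ^ℤ a) (r ^ℤ c * z) (trans (+-comm 1ℚ (r ^ℤ a)) E)

  ii-b≢a : ∀ {z} → (∀ n → z ≢ r ^ℤ n) → ∀ a b c → r ^ℤ a + 1ℚ ≡ r ^ℤ b + r ^ℤ c * z → b ≢ a
  ii-b≢a {z} z∉r^ℤ a b c E refl = z*r^≢r^ z∉r^ℤ c (+ 0) (sym (trans 1≡rᶜz (*-comm (r ^ℤ c) z)))
    where
    1≡rᶜz : 1ℚ ≡ r ^ℤ c * z
    1≡rᶜz = ℚ+.∙-cancelˡ (r ^ℤ a) 1ℚ (r ^ℤ c * z) E

  ii-eliminate-z : ∀ {z} a b c a′ b′ c′ →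
                   r ^ℤ a + 1ℚ ≡ r ^ℤ b + r ^ℤ c * z → r ^ℤ a′ + 1ℚ ≡ r ^ℤ b′ + r ^ℤ c′ * z →
                   powerSum (a ℤ.+ c′ ∷ c′ ∷ b′ ℤ.+ c ∷ []) ≡ powerSum (a′ ℤ.+ c ∷ c ∷ b ℤ.+ c′ ∷ [])
  ii-eliminate-z {z} a b c a′ b′ c′ E E′ = begin
    r ^ℤ (a ℤ.+ c′) + (r ^ℤ c′ + (r ^ℤ (b′ ℤ.+ c) + 0ℚ))
      ≡⟨ cong₂ (λ s t → s + (r ^ℤ c′ + (t + 0ℚ))) (^ℤ-+ r≢0 a c′) (^ℤ-+ r≢0 b′ c) ⟩
    rᵃ * rᶜ′ + (rᶜ′ + (rᵇ′ * rᶜ + 0ℚ))   ≡⟨ step₁ rᵃ rᶜ′ rᵇ′ rᶜ ⟩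
    (rᵃ + 1ℚ) * rᶜ′ + rᵇ′ * rᶜ           ≡⟨ cong (λ t → t * rᶜ′ + rᵇ′ * rᶜ) E ⟩
    (rᵇ + rᶜ * z) * rᶜ′ + rᵇ′ * rᶜ       ≡⟨ step₂ rᵇ rᶜ z rᶜ′ rᵇ′ ⟩
    rᵇ * rᶜ′ + (rᵇ′ + rᶜ′ * z) * rᶜ      ≡⟨ cong (λ t → rᵇ * rᶜ′ + t * rᶜ) (sym E′) ⟩
    rᵇ * rᶜ′ + (rᵃ′ + 1ℚ) * rᶜ           ≡⟨ step₃ rᵇ rᶜ′ rᵃ′ rᶜ ⟩
    rᵃ′ * rᶜ + (rᶜ + (rᵇ * rᶜ′ + 0ℚ))
      ≡⟨ cong₂ (λ s t → s + (r ^ℤ c + (t + 0ℚ))) (sym (^ℤ-+ r≢0 a′ c)) (sym (^ℤ-+ r≢0 b c′)) ⟩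
    r ^ℤ (a′ ℤ.+ c) + (r ^ℤ c + (r ^ℤ (b ℤ.+ c′) + 0ℚ))  ∎
    where
    open ≡-Reasoning
    rᵃ rᵇ rᶜ rᵃ′ rᵇ′ rᶜ′ : ℚ
    rᵃ = r ^ℤ a
    rᵇ = r ^ℤ b
    rᶜ = r ^ℤ c
    rᵃ′ = r ^ℤ a′
    rᵇ′ = r ^ℤ b′
    rᶜ′ = r ^ℤ c′
    step₁ : ∀ x y u v → x * y + (y + (u * v + 0ℚ)) ≡ (x + 1ℚ) * y + u * v
    step₁ = solve 4 (λ x y u v → x :* y :+ (y :+ (u :* v :+ con 0ℚ)) := (x :+ con 1ℚ) :* y :+ u :* v) refl
    step₂ : ∀ x y z w u → (x + y * z) * w + u * y ≡ x * w + (u + w * z) * y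
    step₂ = solve 5 (λ x y z w u → (x :+ y :* z) :* w :+ u :* y := x :* w :+ (u :+ w :* z) :* y) refl
    step₃ : ∀ x y u v → x * y + (u + 1ℚ) * v ≡ u * v + (v + (x * y + 0ℚ))
    step₃ = solve 4 (λ x y u v → x :* y :+ (u :+ con 1ℚ) :* v := u :* v :+ (v :+ (x :* y :+ con 0ℚ))) refl

  part-ii : 3 ℕ.≤ p → ∀ {z} → (∀ n → z ≢ r ^ℤ n) → ∀ a b c a′ b′ c′ →
            + 0 ℤ.≤ a → r ^ℤ a + 1ℚ ≡ r ^ℤ b + r ^ℤ c * z →
            + 0 ℤ.≤ a′ → r ^ℤ a′ + 1ℚ ≡ r ^ℤ b′ + r ^ℤ c′ * z →
            a ≡ a′ × b ≡ b′ × c ≡ c′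
  part-ii 3≤p z∉r^ℤ (+ A) b c (+ A′) b′ c′ _ E _ E′ =
    conclude (exponents-match (ii-b≢0 z∉r^ℤ (+ A) b c E) (ii-b≢0 z∉r^ℤ (+ A′) b′ c′ E′) (ii-b≢a z∉r^ℤ (+ A) b c E)
      (powerSum-unique (+ A ℤ.+ c′ ∷ c′ ∷ b′ ℤ.+ c ∷ []) (+ A′ ℤ.+ c ∷ c ∷ b ℤ.+ c′ ∷ []) refl 3≤p
        (ii-eliminate-z (+ A) b c (+ A′) b′ c′ E E′)))
    where
    conclude : A ≡ A′ × b ≡ b′ × c ≡ c′ → + A ≡ + A′ × b ≡ b′ × c ≡ c′
    conclude (A≡A′ , b≡b′ , c≡c′) = cong +_ A≡A′ , b≡b′ , c≡c′

lemma3p5 : (r z : ℚ) → 1ℚ < r → 0ℚ < z → ((n : ℤ) → z ≢ r ^ℤ n) →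
    ((r ≢ 1ℚ + 1ℚ) →
      ((a b c a′ b′ c′ : ℤ) →
        + 0 ≤ℤ a → c ≤ℤ b → r ^ℤ a + 1ℚ ≡ (r ^ℤ b + r ^ℤ c) * z →
        + 0 ≤ℤ a′ → c′ ≤ℤ b′ → r ^ℤ a′ + 1ℚ ≡ (r ^ℤ b′ + r ^ℤ c′) * z →
        a ≡ a′ × b ≡ b′ × c ≡ c′)
      ×
      ((a b c a′ b′ c′ : ℤ) →
        + 0 ≤ℤ a → r ^ℤ a + 1ℚ ≡ r ^ℤ b + r ^ℤ c * z →
        + 0 ≤ℤ a′ → r ^ℤ a′ + 1ℚ ≡ r ^ℤ b′ + r ^ℤ c′ * z →
        a ≡ a′ × b ≡ b′ × c ≡ c′))
    ×
    ((a b c a′ b′ c′ : ℤ) →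
      + 0 <ℤ a → r ^ℤ a - 1ℚ ≡ (r ^ℤ b - r ^ℤ c) * z →
      + 0 <ℤ a′ → r ^ℤ a′ - 1ℚ ≡ (r ^ℤ b′ - r ^ℤ c′) * z →
      a ≡ a′ × b ≡ b′ × c ≡ c′)
lemma3p5 r z 1<r 0<z z∉r^ℤ =
  (λ r≢2 → part-i r 1<r (3≤∣↥∣ 1<r r≢2) z∉r^ℤ , part-ii r 1<r (3≤∣↥∣ 1<r r≢2) z∉r^ℤ) ,
  part-iii r 1<r 0<z z∉r^ℤ
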